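{- Let $\langle S,\to\rangle$ be a parallel transaction system over a finite thread set $T$ (as in the context). Suppose an ots contains a step $r\to_i r'$ (i.e. $r$ is a state on the ots and the next transition is by thread $i$) with $r\notin\mathcal N_j$ for some thread $j\ne i$. Then the suffix of the ots starting at $r$ contains no transition of thread $j$.
   Context: Notation: for $X\subseteq S$, $Q\subseteq S\times S$: $X\lhd Q=Q\cap(X\times S)$, $Q\rhd X=Q\cap(S\times X)$; for $X\subseteq T$, $\mathcal N_X=\bigcap_{i\in X}\mathcal N_i$. A transition system over $T$ is $\langle S,\to\rangle$ with $\to=\bigcup_{i\in T}\to_i$. A thread bisimulation is an equivalence $R$ on $S$ such that $(\sigma,\sigma')\in R$ and $\sigma\to_i\sigma_1$ imply $\sigma'\to_i\sigma_1'$ for some $\sigma_1'$ with $(\sigma_1,\sigma_1')\in R$. For $A,B\subseteq S\times S$ and equivalence $R$: $A$ right-commutes with $B$ up to $R$ iff whenever $(\sigma_1,\sigma_2)\in A,(\sigma_2,\sigma_3)\in B$ there are $\sigma_4,\sigma_3'$ with $(\sigma_1,\sigma_4)\in B,(\sigma_4,\sigma_3')\in A,(\sigma_3,\sigma_3')\in R$; $A$ left-commutes with $B$ up to $R$ iff whenever $(\sigma_1,\sigma_2)\in B,(\sigma_2,\sigma_3)\in A$ there are $\sigma_4,\sigma_3'$ with $(\sigma_1,\sigma_4)\in A,(\sigma_4,\sigma_3')\in B,(\sigma_3,\sigma_3')\in R$. Phase-annotated system: for each $i$ sets $\mathcal R_i,\mathcal L_i,\mathcal N_i$ and a thread bisimulation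 $\cong_i$ with, for all $i$, $j\ne i$: $S=\mathcal R_i\uplus\mathcal L_i\uplus\mathcal N_i$; $\to_i\cap\to_j=\emptyset$; $\to_i\subseteq\mathcal L_j^2\cup\mathcal R_j^2\cup\mathcal N_j^2$; $\cong_i\subseteq\mathcal L_j^2\cup\mathcal R_j^2\cup\mathcal N_j^2$. For $X\subseteq T$, $\cong_X=(\bigcup_{i\in X}\cong_i)^*$. Parallel transaction system: additionally for all $i$, $j\ne i$: $\mathcal L_i\lhd\to_i\rhd\mathcal R_i=\emptyset$; $\to_i\rhd\mathcal R_i$ right-commutes with $\to_j$ up to $\cong_{\{j\}}$; $\mathcal L_i\lhd\to_i$ left-commutes with $\to_j$ up to $\cong_{\{i,j\}}$; every $\sigma\in\mathcal L_i$ has some $\sigma'\in\mathcal N_i$ with $\sigma\to_i^{+}\sigma'$. Transitions are attributed to threads since the $\to_i$ are pairwise disjoint. A uts under $T'$ is a path $q_1\to_{\psi(1)}^{+}q_2\cdots\to_{\psi(l)}^{+}q_{l+1}$ ($l\ge0$) whose blocks are $q_k=q_{k,1}\to_{\psi(k)}\cdots\to_{\psi(k)}q_{k,x_k}=q_{k+1}$ with $\psi(k)\in T'$, $q_1\in\mathcal N_{T'}$, $q_{k,1}\in\mathcal N_{\psi(k)}$, $q_{k,2},\dots,q_{k,x_k}\in\mathcal R_{\psi(k)}$. A cts under $T'$ is a path $p_1\to_{\varphi(1)}^{+}p_2\cdots\to_{\varphi(k)}^{+}p_{k+1}$ ($k\ge0$) whose blocks are $p_m=p_{m,1}\to_{\varphi(m)}\cdots\to_{\varphi(m)}p_{m,x_m}=p_{m+1}$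 with $\varphi(m)\in T'$, $p_1\in\mathcal N_{T'}$, $p_{m,1}\in\mathcal N_{\varphi(m)}$, $p_{m,2},\dots,p_{m,x_m-1}\in\mathcal R_{\varphi(m)}\cup\mathcal L_{\varphi(m)}$, $p_{m,x_m}\in\mathcal L_{\varphi(m)}\cup\mathcal N_{\varphi(m)}$. If $A$ is a cts under $T_A$ and $B$ a uts under $T_B$ starting in the last state of $A$, the concatenation $AB$ is an ots (open transaction sequence) under $T_A\cup T_B$. -}

module Defs where

open import Level using (0ℓ)
open import Data.Nat using (ℕ)
open import Data.Fin using (Fin)
open import Data.Product using (Σ; ∃; ∃₂; _×_; _,_)
open import Data.Sum using (_⊎_)
open import Data.Empty using (⊥)
open import Data.List using (List; []; _∷_)
open import Relation.Nullary using (¬_)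
open import Relation.Binary.PropositionalEquality using (_≡_; _≢_)
open import Relation.Binary.Core using (Rel)
open import Relation.Binary.Structures using (IsEquivalence)
open import Relation.Binary.Construct.Closure.ReflexiveTransitive using (Star)
open import Relation.Binary.Construct.Closure.Transitive using (TransClosure)

module _ {S : Set} where

  _◁_ : (S → Set) → Rel S 0ℓ → Rel S 0ℓ
  (X ◁ Q) a b = X a × Q a b

  _▷_ : Rel S 0ℓ → (S → Set) → Rel S 0ℓ
  (Q ▷ X) a b = Q a b × X b

  RightCommutes : Rel S 0ℓ → Rel S 0ℓ → Rel S 0ℓ → Set
  RightCommutes A B R = ∀ {σ₁ σ₂ σ₃} → A σ₁ σ₂ → B σ₂ σ₃ →
    ∃₂ λ σ₄ σ₃' → B σ₁ σ₄ × A σ₄ σ₃' × R σ₃ σ₃'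

  LeftCommutes : Rel S 0ℓ → Rel S 0ℓ → Rel S 0ℓ → Set
  LeftCommutes A B R = ∀ {σ₁ σ₂ σ₃} → B σ₁ σ₂ → A σ₂ σ₃ →
    ∃₂ λ σ₄ σ₃' → A σ₁ σ₄ × B σ₄ σ₃' × R σ₃ σ₃'

  _⊆Squares_,_,_ : Rel S 0ℓ → (S → Set) → (S → Set) → (S → Set) → Set
  Q ⊆Squares X , Y , Z = ∀ {a b} → Q a b → (X a × X b) ⊎ (Y a × Y b) ⊎ (Z a × Z b)

record TransitionSystem : Set₁ where
  field
    n     : ℕ                          -- T = Fin n (finite thread set)
    S     : Set
    Step  : Fin n → Rel S 0ℓ

  _⟶_ : Rel S 0ℓ
  σ ⟶ σ' = ∃ λ i → Step i σ σ'

  IsThreadBisimulation : Rel S 0ℓ → Set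
  IsThreadBisimulation R = IsEquivalence R ×
    (∀ {σ σ' σ₁} (i : Fin n) → R σ σ' → Step i σ σ₁ →
       ∃ λ σ₁' → Step i σ' σ₁' × R σ₁ σ₁')

record PhaseAnnotated (TS : TransitionSystem) : Set₁ where
  open TransitionSystem TS
  field
    R L N   : Fin n → S → Set
    Cong    : Fin n → Rel S 0ℓ
    Cong-bisim : ∀ i → IsThreadBisimulation (Cong i)
    cover   : ∀ i σ → R i σ ⊎ L i σ ⊎ N i σ
    R∩L     : ∀ i σ → R i σ → L i σ → ⊥
    R∩N     : ∀ i σ → R i σ → N i σ → ⊥
    L∩N     : ∀ i σ → L i σ → N i σ → ⊥
    step-disjoint : ∀ i j → j ≢ i → ∀ {σ σ'} → Step i σ σ' → Step j σ σ' → ⊥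
    step-phase : ∀ i j → j ≢ i → Step i ⊆Squares L j , R j , N j
    cong-phase : ∀ i j → j ≢ i → Cong i ⊆Squares L j , R j , N j

  N[_] : (Fin n → Set) → S → Set
  N[ X ] σ = ∀ i → X i → N i σ

  Cong[_] : (Fin n → Set) → Rel S 0ℓ
  Cong[ X ] = Star (λ a b → ∃ λ i → X i × Cong i a b)

record ParallelTransactionSystem : Set₁ where
  field
    TS : TransitionSystem
    PA : PhaseAnnotated TS
  open TransitionSystem TS public
  open PhaseAnnotated PA public
  field
    no-L→R : ∀ i {σ σ'} → L i σ → Step i σ σ' → R i σ' → ⊥
    right-comm : ∀ i j → j ≢ i →
      RightCommutes (Step i ▷ R i) (Step j) Cong[ (λ k → k ≡ j) ]
    left-comm : ∀ i j → j ≢ i →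
      LeftCommutes (L i ◁ Step i) (Step j) Cong[ (λ k → k ≡ i ⊎ k ≡ j) ]
    L-progress : ∀ i σ → L i σ → ∃ λ σ' → N i σ' × TransClosure (Step i) σ σ'

module Paths (P : ParallelTransactionSystem) where
  open ParallelTransactionSystem P

  -- A path with explicit thread labels (labels are determined, since the
  -- →ᵢ are pairwise disjoint).
  data Path : S → S → Set where
    []   : ∀ {s} → Path s s
    step : ∀ {s s' t} (i : Fin n) → Step i s s' → Path s' t → Path s t

  infixr 5 _++_
  _++_ : ∀ {s t u} → Path s t → Path t u → Path s u
  [] ++ q = q
  step i e p ++ q = step i e (p ++ q)

  threads : ∀ {s t} → Path s t → List (Fin n)
  threads [] = []
  threads (step i _ p) = i ∷ threads p

  data RRun (i : Fin n) : ∀ {s t} → Path s t → Set where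
    []   : ∀ {s} → RRun i ([] {s})
    step : ∀ {s s' t} (e : Step i s s') {p : Path s' t} →
           R i s' → RRun i p → RRun i (step i e p)

  data UBlock (i : Fin n) : ∀ {s t} → Path s t → Set where
    ublock : ∀ {s s' t} (e : Step i s s') {p : Path s' t} →
             N i s → R i s' → RRun i p → UBlock i (step i e p)

  -- tail of a cts block after its first step, starting at p_{m,2}:
  -- states p_{m,2} … p_{m,x-1} ∈ Rᵢ ∪ Lᵢ, last state p_{m,x} ∈ Lᵢ ∪ Nᵢ
  data CTail (i : Fin n) : ∀ {s t} → Path s t → Set where
    end  : ∀ {s} → L i s ⊎ N i s → CTail i ([] {s})
    step : ∀ {s s' t} (e : Step i s s') {p : Path s' t} →
           R i s ⊎ L i s → CTail i p → CTail i (step i e p)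

  data CBlock (i : Fin n) : ∀ {s t} → Path s t → Set where
    cblock : ∀ {s s' t} (e : Step i s s') {p : Path s' t} →
             N i s → CTail i p → CBlock i (step i e p)

  data UBlocks (T' : Fin n → Set) : ∀ {s t} → Path s t → Set where
    []  : ∀ {s} → UBlocks T' ([] {s})
    _∷_ : ∀ {s t u i} {b : Path s t} {p : Path t u} →
          (T' i × UBlock i b) → UBlocks T' p → UBlocks T' (b ++ p)

  data CBlocks (T' : Fin n → Set) : ∀ {s t} → Path s t → Set where
    []  : ∀ {s} → CBlocks T' ([] {s})
    _∷_ : ∀ {s t u i} {b : Path s t} {p : Path t u} →
          (T' i × CBlock i b) → CBlocks T' p → CBlocks T' (b ++ p)

  UTS : (T' : Fin n → Set) → ∀ {s t} → Path s t → Set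
  UTS T' {s} p = N[ T' ] s × UBlocks T' p

  CTS : (T' : Fin n → Set) → ∀ {s t} → Path s t → Set
  CTS T' {s} p = N[ T' ] s × CBlocks T' p

  OTS : (TA TB : Fin n → Set) → ∀ {s u} → Path s u → Set
  OTS TA TB {s} {u} p = ∃ λ t → Σ (Path s t) λ A → Σ (Path t u) λ B →
    CTS TA A × UTS TB B × p ≡ A ++ B

-- Every block of an ots is a run of a single thread starting in N of that
-- thread, so each maximal run of j-steps begins in N_j. Steps of threads other
-- than j stay inside one of Lⱼ, Rⱼ, Nⱼ, so along the suffix from r ∉ N_j every
-- state reached by non-j steps is outside N_j; a j-step could therefore only
-- continue a j-run, and none is in progress since the step out of r is by i ≠ j.
module Submission where

open import Defs
open import Data.Fin using (Fin; _≟_)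
open import Data.Bool using (Bool; true; false)
open import Data.Product using (∃; _,_)
open import Data.Sum using (_⊎_; inj₁; inj₂)
open import Data.Empty using (⊥-elim)
open import Data.List.Relation.Unary.All using (All; []; _∷_)
open import Relation.Nullary using (¬_; yes; no)
open import Relation.Binary.PropositionalEquality using (_≡_; _≢_; refl; sym; subst)

module _ (P : ParallelTransactionSystem) where
  open ParallelTransactionSystem P
  open Paths P

  N-backward : ∀ {k j s s'} → k ≢ j → Step k s s' → N j s' → N j s
  N-backward {k} {j} k≢j e ns' with step-phase k j (λ j≡k → k≢j (sym j≡k)) e
  ... | inj₁ (_ , l)        = ⊥-elim (L∩N j _ l ns')
  ... | inj₂ (inj₁ (_ , r)) = ⊥-elim (R∩N j _ r ns')
  ... | inj₂ (inj₂ (ns , _)) = ns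

  RRun⇒single-thread : ∀ {i s t} {p : Path s t} → RRun i p → All (_≡ i) (threads p)
  RRun⇒single-thread []             = []
  RRun⇒single-thread (step _ _ run) = refl ∷ RRun⇒single-thread run

  CTail⇒single-thread : ∀ {i s t} {p : Path s t} → CTail i p → All (_≡ i) (threads p)
  CTail⇒single-thread (end _)         = []
  CTail⇒single-thread (step _ _ tail) = refl ∷ CTail⇒single-thread tail

  module RunsOf (j : Fin n) where

    -- JRuns inRun p: every maximal run of j-steps in p starts in N j, where
    -- inRun records whether p is entered directly after a j-step.
    data JRuns : Bool → ∀ {s t} → Path s t → Set where
      []         : ∀ {inRun s} → JRuns inRun ([] {s})
      j-step     : ∀ {inRun s s' t} (e : Step j s s') {p : Path s' t} →
                   inRun ≡ true ⊎ N j s → JRuns true p → JRuns inRun (step j e p)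
      other-step : ∀ {inRun k s s' t} (e : Step k s s') {p : Path s' t} →
                   k ≢ j → JRuns false p → JRuns inRun (step k e p)

    JRuns-++ : ∀ {inRun s t u} {p : Path s t} {q : Path t u} →
               JRuns inRun p → (∀ b → JRuns b q) → JRuns inRun (p ++ q)
    JRuns-++ []                   q-runs = q-runs _
    JRuns-++ (j-step e start rs)  q-runs = j-step e start (JRuns-++ rs q-runs)
    JRuns-++ (other-step e k≢j rs) q-runs = other-step e k≢j (JRuns-++ rs q-runs)

    JRuns-suffix : ∀ {inRun s t u} (p : Path s t) {q : Path t u} →
                   JRuns inRun (p ++ q) → ∃ λ b → JRuns b q
    JRuns-suffix []             rs                  = _ , rs
    JRuns-suffix (step _ _ p)   (j-step _ _ rs)     = JRuns-suffix p rs
    JRuns-suffix (step _ _ p)   (other-step _ _ rs) = JRuns-suffix p rs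

    j-only⇒JRuns : ∀ {s t} {p : Path s t} → All (_≡ j) (threads p) → JRuns true p
    j-only⇒JRuns {p = []}         []         = []
    j-only⇒JRuns {p = step _ e p} (refl ∷ js) = j-step e (inj₁ refl) (j-only⇒JRuns js)

    other-only⇒JRuns : ∀ {i s t} {p : Path s t} → i ≢ j → All (_≡ i) (threads p) →
                       ∀ b → JRuns b p
    other-only⇒JRuns {p = []}         _   []          _ = []
    other-only⇒JRuns {p = step _ e p} i≢j (refl ∷ is) _ =
      other-step e i≢j (other-only⇒JRuns i≢j is false)

    block⇒JRuns : ∀ {i s s' t} (e : Step i s s') {p : Path s' t} →
                  N i s → All (_≡ i) (threads p) → ∀ b → JRuns b (step i e p)
    block⇒JRuns {i} e ns is b with i ≟ j
    ... | yes refl = j-step e (inj₂ ns) (j-only⇒JRuns is)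
    ... | no i≢j   = other-step e i≢j (other-only⇒JRuns i≢j is false)

    UBlocks⇒JRuns : ∀ {T' s t} {p : Path s t} → UBlocks T' p → ∀ b → JRuns b p
    UBlocks⇒JRuns []                               _ = []
    UBlocks⇒JRuns ((_ , ublock e ns _ run) ∷ bs) b =
      JRuns-++ (block⇒JRuns e ns (RRun⇒single-thread run) b) (UBlocks⇒JRuns bs)

    CBlocks⇒JRuns : ∀ {T' s t} {p : Path s t} → CBlocks T' p → ∀ b → JRuns b p
    CBlocks⇒JRuns []                              _ = []
    CBlocks⇒JRuns ((_ , cblock e ns tail) ∷ bs) b =
      JRuns-++ (block⇒JRuns e ns (CTail⇒single-thread tail) b) (CBlocks⇒JRuns bs)

    OTS⇒JRuns : ∀ {TA TB s u} {p : Path s u} → OTS TA TB p → JRuns false p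
    OTS⇒JRuns (_ , _ , _ , (_ , cts) , (_ , uts) , refl) =
      JRuns-++ (CBlocks⇒JRuns cts false) (UBlocks⇒JRuns uts)

    JRuns-outside-N : ∀ {s t} {p : Path s t} → JRuns false p → ¬ N j s →
                      All (_≢ j) (threads p)
    JRuns-outside-N []                     _  = []
    JRuns-outside-N (j-step _ (inj₁ ()) _) _
    JRuns-outside-N (j-step _ (inj₂ ns) _) ¬ns = ⊥-elim (¬ns ns)
    JRuns-outside-N (other-step e k≢j rs)  ¬ns =
      k≢j ∷ JRuns-outside-N rs (λ ns' → ¬ns (N-backward k≢j e ns'))

corollary8 : (P : ParallelTransactionSystem) →
    let open ParallelTransactionSystem P
        open Paths P
    in ∀ (TA TB : Fin n → Set) {s u r r' : S} (p : Path s u) → OTS TA TB p →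
       ∀ (i j : Fin n) (pre : Path s r) (e : Step i r r') (suf : Path r' u) →
       p ≡ pre ++ step i e suf → ¬ N j r → j ≢ i →
       All (λ k → k ≢ j) (threads (step i e suf))
corollary8 P TA TB p ots i j pre e suf p≡ ¬Nr j≢i =
  JRuns-outside-N (after-i (JRuns-suffix pre (subst (JRuns false) p≡ (OTS⇒JRuns ots)))) ¬Nr
  where
  open Paths P
  open RunsOf P j
  after-i : (∃ λ b → JRuns b (step i e suf)) → JRuns false (step i e suf)
  after-i (_ , j-step _ _ _)        = ⊥-elim (j≢i refl)
  after-i (_ , other-step _ i≢j rs) = other-step e i≢j rs
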